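{- Let $t,m\geq 1$ be integers, and set $k=3t+1$ and $n=4km$. Let $G$ be any graph in the support of the distribution $\mu_{\mathrm{ngc}}$ defined in the context, and let $\theta$ be the bit used to generate it. Then: (i) if $\theta=0$, $G$ has $n/(2k)$ vertex-disjoint cycles of length $k$; (ii) if $\theta=1$, $G$ has $n/(4k)$ vertex-disjoint cycles of length $2k$. In either case, $G$ additionally has $n/(2k)$ vertex-disjoint paths of length $k-1$.
   Context: Group-layered graphs. A group-layered graph of width $w$ and depth $d$ has vertex layers $V^1,\dots,V^d$. Each layer is a copy of $[2w]$ and is partitioned into $w$ groups $g^i_j=(a^i_j,b^i_j)$, $j\in[w]$. Its edges are perfect matchings between consecutive layers. Concatenation. For graphs $G_1$ of depth $d_1$ and $G_2$ of depth $d_2$ with the same width, $G_1\Vert G_2$ is the graph of depth $d_1+d_2-1$ obtained by identifying the last layer of $G_1$ with the first layer of $G_2$ and taking the union of the edges. Perm-matching. For $\sigma\in\mathcal S_w$ (permutations of $[w]$), $\mathrm{PermMatch}(\sigma)$ is the 2-layer graph with edges $(a^1_j,a^2_{\sigma(j)})$ and $(b^1_j,b^2_{\sigma(j)})$ for all $j\in[w]$. XOR-matching. For $x\in\{0,1\}^w$, $\mathrm{XorMatch}(x)$ is the 2-layer graph with edges $(a^1_j,a^2_j),(b^1_j,b^2_j)$ if $x_j=0$, and edges $(a^1_j,b^2_j),(b^1_j,a^2_j)$ if $x_j=1$, for each $j\in[w]$. Blocks. $\mathrm{Block}(x,\sigma)=\mathrm{PermMatch}(\sigma)\Vert \mathrm{XorMatch}(x)\Vert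 \mathrm{PermMatch}(\sigma^{ -1})$; it has 4 layers. Multi-block graphs. For $X=(x^1,\dots,x^t)\in(\{0,1\}^w)^t$ and $\Sigma=(\sigma^1,\dots,\sigma^t)\in(\mathcal S_w)^t$, $\mathrm{MultiBlock}(X,\Sigma)=\mathrm{Block}(x^1,\sigma^1)\Vert\cdots\Vert\mathrm{Block}(x^t,\sigma^t)$; it has width $w$ and depth $3t+1$. Distribution $\mu_{\mathrm{ngc}}$ (for $k=3t+1$, $n=4km$). Sample $\theta\in\{0,1\}$ uniformly. Sample $X\in(\{0,1\}^{2m})^t$ and $\Sigma\in(\mathcal S_{2m})^t$ uniformly at random, conditioned on $\bigoplus_{i\in[t]}x^i_{\sigma^i(j)}=\theta$ for all $j\in[m]$. Output $G=\mathrm{MultiBlock}(X,\Sigma)$ (width $2m$, depth $k$), together with the auxiliary edges $(a^k_j,a^1_j)$ and $(b^k_j,b^1_j)$ for every $j\in[m]$. -}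

module Defs where

open import Data.Nat using (ℕ; zero; suc; _+_; _*_; _<_; _≤_)
open import Data.Fin using (Fin; zero; suc; toℕ; inject₁; fromℕ)
open import Data.Fin.Permutation using (Permutation′; _⟨$⟩ʳ_; flip)
open import Data.Bool using (Bool; true; false; _xor_)
open import Data.Product using (Σ; _×_; _,_; proj₁)
open import Data.Sum using (_⊎_)
open import Data.List using (List; []; _∷_; _++_; length; lookup)
open import Data.Vec using (Vec; []; _∷_; foldr′; zipWith)
open import Relation.Binary.PropositionalEquality using (_≡_; _≢_)

-- A slot of a layer (a copy of [2w]) : group j ∈ Fin w and side
-- (false = a^i_j, true = b^i_j).
Slot : ℕ → Set
Slot w = Fin w × Bool

-- A perfect matching between two consecutive layers, given as the
-- bijection it induces: edge set {(u, f u) | u ∈ Slot w}.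
Matching : ℕ → Set
Matching w = Slot w → Slot w

-- A group-layered graph of width w is the list of its consecutive-layer
-- matchings; its depth is (length + 1).
LGraph : ℕ → Set
LGraph w = List (Matching w)

depth : ∀ {w} → LGraph w → ℕ
depth G = suc (length G)

-- Concatenation: identify last layer of G1 with first layer of G2 and take
-- the union of edges; depth d1 + d2 - 1.
_∥_ : ∀ {w} → LGraph w → LGraph w → LGraph w
G₁ ∥ G₂ = G₁ ++ G₂

PermMatch : ∀ {w} → Permutation′ w → LGraph w
PermMatch σ = (λ { (j , s) → (σ ⟨$⟩ʳ j , s) }) ∷ []

XorMatch : ∀ {w} → (Fin w → Bool) → LGraph w
XorMatch x = (λ { (j , s) → (j , s xor x j) }) ∷ []

Block : ∀ {w} → (Fin w → Bool) → Permutation′ w → LGraph w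
Block x σ = PermMatch σ ∥ (XorMatch x ∥ PermMatch (flip σ))

MultiBlock : ∀ {w t} → Vec (Fin w → Bool) t → Vec (Permutation′ w) t → LGraph w
MultiBlock [] [] = []
MultiBlock (x ∷ X) (σ ∷ Σs) = Block x σ ∥ MultiBlock X Σs

Vertex : ∀ {w} → LGraph w → Set
Vertex {w} G = Fin (depth G) × Slot w

LayerEdge : ∀ {w} (G : LGraph w) → Vertex G → Vertex G → Set
LayerEdge G (i , u) (i' , u') =
  Σ (Fin (length G)) λ e → (i ≡ inject₁ e) × (i' ≡ suc e) × (u' ≡ lookup G e u)

AuxEdge : ∀ {w} (m : ℕ) (G : LGraph w) → Vertex G → Vertex G → Set
AuxEdge m G (i , (j , s)) (i' , (j' , s')) =
  (i ≡ fromℕ (length G)) × (i' ≡ zero) × (j ≡ j') × (s ≡ s') × (toℕ j < m)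

NGCAdj : ∀ {w} (m : ℕ) (G : LGraph w) → Vertex G → Vertex G → Set
NGCAdj m G u v =
  LayerEdge G u v ⊎ LayerEdge G v u ⊎ AuxEdge m G u v ⊎ AuxEdge m G v u

ParityCond : ∀ {t} (m : ℕ) → Bool → Vec (Fin (2 * m) → Bool) t
           → Vec (Permutation′ (2 * m)) t → Set
ParityCond m θ X Σs =
  ∀ (j : Fin (2 * m)) → toℕ j < m →
    foldr′ _xor_ false (zipWith (λ x σ → x (σ ⟨$⟩ʳ j)) X Σs) ≡ θ

Injective : ∀ {A V : Set} → (A → V) → Set
Injective f = ∀ a b → f a ≡ f b → a ≡ b

IsPath : ∀ {V : Set} (Adj : V → V → Set) (ℓ : ℕ) → (Fin (suc ℓ) → V) → Set
IsPath Adj ℓ c =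
  Injective c × (∀ i j → suc (toℕ i) ≡ toℕ j → Adj (c i) (c j))

IsCycle : ∀ {V : Set} (Adj : V → V → Set) (L : ℕ) → (Fin L → V) → Set
IsCycle Adj L c =
  (3 ≤ L) × Injective c ×
  (∀ i j → (suc (toℕ i) ≡ toℕ j) ⊎ ((suc (toℕ i) ≡ L) × (toℕ j ≡ 0)) →
     Adj (c i) (c j))

Disjoint : ∀ {V : Set} {r L : ℕ} → (Fin r → Fin L → V) → Set
Disjoint F = ∀ p q → p ≢ q → ∀ a b → F p a ≢ F q b

HasDisjointCycles : ∀ {V : Set} (Adj : V → V → Set) (r L : ℕ) → Set
HasDisjointCycles {V} Adj r L =
  Σ (Fin r → Fin L → V) λ F → (∀ p → IsCycle Adj L (F p)) × Disjoint F

HasDisjointPaths : ∀ {V : Set} (Adj : V → V → Set) (r ℓ : ℕ) → Set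
HasDisjointPaths {V} Adj r ℓ =
  Σ (Fin r → Fin (suc ℓ) → V) λ F → (∀ p → IsPath Adj ℓ (F p)) × Disjoint F

-- Every slot u of the first layer determines the path (i , walk i u) through all k layers,
-- and since all matchings are bijections, paths from different slots are vertex-disjoint.
-- Each block maps group j to itself and flips its side iff x(σ j) = 1, so the whole multiblock
-- flips the side of group j by ⊕ᵢ xⁱ(σⁱ j), which is θ for j < m.  Hence for θ = 0 each of the
-- 2m paths starting in the first m groups is closed into a k-cycle by its auxiliary edge, and
-- for θ = 1 the paths starting at aⱼ and bⱼ are joined by two auxiliary edges into a 2k-cycle.
module Submission where

open import Defs
open import Data.Nat using (ℕ; zero; suc; _+_; _*_; _∸_; _/_; _≤_; _<_; z≤n; s≤s; s≤s⁻¹)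
open import Data.Nat.Properties
  using (suc-injective; +-suc; +-identityʳ; +-cancelˡ-≡; +-mono-≤; *-suc; *-monoʳ-≤; ≤-trans; <⇒≤;
         m+1+n≰m; m+n≮m)
open import Data.Nat.DivMod using (m*n/n≡m)
open import Data.Nat.Tactic.RingSolver using (solve-∀)
open import Data.Fin using (Fin; zero; suc; toℕ; fromℕ; fromℕ<; inject₁; _↑ˡ_; _↑ʳ_; splitAt; join)
open import Data.Fin.Properties
  using (toℕ-injective; toℕ-↑ˡ; toℕ-↑ʳ; ↑ˡ-injective; toℕ<n; toℕ-fromℕ; toℕ-fromℕ<; toℕ-inject₁; join-splitAt)
open import Data.Fin.Permutation using (Permutation′; _⟨$⟩ʳ_; _⟨$⟩ˡ_; inverseˡ; flip)
open import Data.Bool using (Bool; true; false; not; _xor_)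
open import Data.Bool.Properties using (xor-assoc; xor-same; xor-identityʳ; xor-comm; true-xor)
open import Data.Product using (Σ; _×_; _,_; proj₁; proj₂; curry; uncurry)
open import Data.Sum using (_⊎_; inj₁; inj₂; [_,_])
open import Data.List using ([]; _∷_; length; lookup)
open import Data.List.Relation.Unary.All using (All; []; _∷_)
open import Data.List.Relation.Unary.All.Properties using (++⁺)
open import Data.Vec using (Vec; []; _∷_; foldr′; zipWith)
open import Data.Vec.Functional using (_++_)
open import Data.Vec.Functional.Properties using (lookup-++ˡ; lookup-++ʳ)
open import Data.Empty using (⊥-elim)
open import Function using (_∘_)
open import Relation.Binary.PropositionalEquality
  using (_≡_; _≢_; refl; sym; trans; cong; cong₂; subst; subst₂; module ≡-Reasoning)

fromℕ-+suc : ∀ a b → fromℕ (a + suc b) ≡ suc a ↑ʳ fromℕ b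
fromℕ-+suc zero    b = refl
fromℕ-+suc (suc a) b = cong suc (fromℕ-+suc a b)

data SplitView (a b : ℕ) : Fin (a + b) → Set where
  left  : (x : Fin a) → SplitView a b (x ↑ˡ b)
  right : (y : Fin b) → SplitView a b (a ↑ʳ y)

splitView : ∀ a b i → SplitView a b i
splitView zero    b i       = right i
splitView (suc a) b zero    = left zero
splitView (suc a) b (suc i) with splitView a b i
... | left x  = left (suc x)
... | right y = right y

data AppendStep (a b : ℕ) : Fin (suc a + suc b) → Fin (suc a + suc b) → Set where
  inLeft  : ∀ {x y : Fin (suc a)} → suc (toℕ x) ≡ toℕ y → AppendStep a b (x ↑ˡ suc b) (y ↑ˡ suc b)
  bridge  : ∀ {x : Fin (suc a)} → toℕ x ≡ a → AppendStep a b (x ↑ˡ suc b) (suc a ↑ʳ zero)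
  inRight : ∀ {x y : Fin (suc b)} → suc (toℕ x) ≡ toℕ y → AppendStep a b (suc a ↑ʳ x) (suc a ↑ʳ y)

appendStep : ∀ a b i j → suc (toℕ i) ≡ toℕ j → AppendStep a b i j
appendStep a b i j h with splitView (suc a) (suc b) i | splitView (suc a) (suc b) j
... | left x | left y = inLeft (subst₂ (λ p q → suc p ≡ q) (toℕ-↑ˡ x (suc b)) (toℕ-↑ˡ y (suc b)) h)
... | left x | right y = step y (suc-injective (subst₂ (λ p q → suc p ≡ q) (toℕ-↑ˡ x (suc b)) (toℕ-↑ʳ (suc a) y) h))
  where
  step : ∀ y → toℕ x ≡ a + toℕ y → AppendStep a b (x ↑ˡ suc b) (suc a ↑ʳ y)
  step zero     e = bridge (trans e (+-identityʳ a))
  step (suc y′) e = ⊥-elim (m+1+n≰m a (subst (_≤ a) e (s≤s⁻¹ (toℕ<n x))))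
... | right x | left y =
  ⊥-elim (m+n≮m (suc a) (toℕ x)
    (subst (_≤ suc a) (sym (subst₂ (λ p q → suc p ≡ q) (toℕ-↑ʳ (suc a) x) (toℕ-↑ˡ y (suc b)) h)) (<⇒≤ (toℕ<n y))))
... | right x | right y =
  inRight (+-cancelˡ-≡ (suc a) _ _
    (trans (+-suc (suc a) (toℕ x)) (subst₂ (λ p q → suc p ≡ q) (toℕ-↑ʳ (suc a) x) (toℕ-↑ʳ (suc a) y) h)))

module _ {V : Set} (Adj : V → V → Set) where

  closePath : ∀ {N} (P : Fin (suc N) → V) → 2 ≤ N → IsPath Adj N P →
              Adj (P (fromℕ N)) (P zero) → IsCycle Adj (suc N) P
  closePath {N} P 2≤N (P-inj , P-adj) closing = s≤s 2≤N , P-inj , adj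
    where
    adj : ∀ i j → (suc (toℕ i) ≡ toℕ j) ⊎ ((suc (toℕ i) ≡ suc N) × (toℕ j ≡ 0)) → Adj (P i) (P j)
    adj i j (inj₁ step)               = P-adj i j step
    adj i j (inj₂ (i-last , j-first)) =
      subst₂ (λ i′ j′ → Adj (P i′) (P j′))
        (toℕ-injective (trans (toℕ-fromℕ N) (sym (suc-injective i-last))))
        (toℕ-injective (sym j-first))
        closing

  appendPaths : ∀ {a b} {P : Fin (suc a) → V} {Q : Fin (suc b) → V} →
                IsPath Adj a P → IsPath Adj b Q → (∀ x y → P x ≢ Q y) →
                Adj (P (fromℕ a)) (Q zero) → IsPath Adj (a + suc b) (P ++ Q)
  appendPaths {a} {b} {P} {Q} (P-inj , P-adj) (Q-inj , Q-adj) P∩Q≡∅ P→Q = inj , adj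
    where
    inj : Injective (P ++ Q)
    inj i j eq with splitView (suc a) (suc b) i | splitView (suc a) (suc b) j
    ... | left x  | left y  = cong (_↑ˡ suc b) (P-inj x y (subst₂ _≡_ (lookup-++ˡ P Q x) (lookup-++ˡ P Q y) eq))
    ... | left x  | right y = ⊥-elim (P∩Q≡∅ x y (subst₂ _≡_ (lookup-++ˡ P Q x) (lookup-++ʳ P Q y) eq))
    ... | right x | left y  = ⊥-elim (P∩Q≡∅ y x (subst₂ _≡_ (lookup-++ˡ P Q y) (lookup-++ʳ P Q x) (sym eq)))
    ... | right x | right y = cong (suc a ↑ʳ_) (Q-inj x y (subst₂ _≡_ (lookup-++ʳ P Q x) (lookup-++ʳ P Q y) eq))

    adj : ∀ i j → suc (toℕ i) ≡ toℕ j → Adj ((P ++ Q) i) ((P ++ Q) j)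
    adj i j step with appendStep a b i j step
    ... | inLeft {x} {y} x→y =
      subst₂ Adj (sym (lookup-++ˡ P Q x)) (sym (lookup-++ˡ P Q y)) (P-adj x y x→y)
    ... | bridge {x} x-last =
      subst₂ Adj (trans (cong P (toℕ-injective (trans (toℕ-fromℕ a) (sym x-last)))) (sym (lookup-++ˡ P Q x)))
        (sym (lookup-++ʳ P Q zero)) P→Q
    ... | inRight {x} {y} x→y =
      subst₂ Adj (sym (lookup-++ʳ P Q x)) (sym (lookup-++ʳ P Q y)) (Q-adj x y x→y)

  joinPaths : ∀ {a b} {P : Fin (suc a) → V} {Q : Fin (suc b) → V} → 2 ≤ a + suc b →
              IsPath Adj a P → IsPath Adj b Q → (∀ x y → P x ≢ Q y) →
              Adj (P (fromℕ a)) (Q zero) → Adj (Q (fromℕ b)) (P zero) →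
              IsCycle Adj (suc a + suc b) (P ++ Q)
  joinPaths {a} {b} {P} {Q} long P-path Q-path P∩Q≡∅ P→Q Q→P =
    closePath (P ++ Q) long (appendPaths P-path Q-path P∩Q≡∅ P→Q) closing
    where
    closing : Adj ((P ++ Q) (fromℕ (a + suc b))) (P zero)
    closing = subst (λ v → Adj v (P zero))
                (sym (trans (cong (P ++ Q) (fromℕ-+suc a b)) (lookup-++ʳ P Q (fromℕ b)))) Q→P

walk : ∀ {w} (G : LGraph w) → Fin (depth G) → Slot w → Slot w
walk G       zero     u = u
walk []      (suc ()) u
walk (f ∷ G) (suc i)  u = walk G i (f u)

walkEnd : ∀ {w} (G : LGraph w) → Slot w → Slot w
walkEnd G = walk G (fromℕ (length G))

walkPath : ∀ {w} (G : LGraph w) → Slot w → Fin (depth G) → Vertex G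
walkPath G u i = (i , walk G i u)

walk-suc : ∀ {w} (G : LGraph w) e u → walk G (suc e) u ≡ lookup G e (walk G (inject₁ e) u)
walk-suc (f ∷ G) zero    u = refl
walk-suc (f ∷ G) (suc e) u = walk-suc G e (f u)

walk-injective : ∀ {w} {G : LGraph w} → All Injective G → ∀ i u v → walk G i u ≡ walk G i v → u ≡ v
walk-injective _              zero    u v eq = eq
walk-injective {G = f ∷ G} (f-inj ∷ G-inj) (suc i) u v eq = f-inj u v (walk-injective G-inj i (f u) (f v) eq)

walkPath-injective : ∀ {w} {G : LGraph w} → All Injective G →
                     ∀ {u v} i j → walkPath G u i ≡ walkPath G v j → u ≡ v
walkPath-injective {G = G} G-inj {u} {v} i j eq =
  walk-injective G-inj j u v (subst (λ i′ → walk G i′ u ≡ walk G j v) (cong proj₁ eq) (cong proj₂ eq))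

walk-layerEdge : ∀ {w} (G : LGraph w) u i j → suc (toℕ i) ≡ toℕ j →
                 LayerEdge G (walkPath G u i) (walkPath G u j)
walk-layerEdge G u i j step =
  e , i≡e , j≡e+1 , subst₂ (λ i′ j′ → walk G j′ u ≡ lookup G e (walk G i′ u)) (sym i≡e) (sym j≡e+1) (walk-suc G e u)
  where
  i<N : toℕ i < length G
  i<N = subst (_≤ length G) (sym step) (s≤s⁻¹ (toℕ<n j))
  e : Fin (length G)
  e = fromℕ< i<N
  i≡e : i ≡ inject₁ e
  i≡e = toℕ-injective (sym (trans (toℕ-inject₁ e) (toℕ-fromℕ< i<N)))
  j≡e+1 : j ≡ suc e
  j≡e+1 = toℕ-injective (trans (sym step) (cong suc (sym (toℕ-fromℕ< i<N))))

HasAuxEdge : ∀ {w} → ℕ → Slot w → Set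
HasAuxEdge m u = toℕ (proj₁ u) < m

walkPath-isPath : ∀ {w} m (G : LGraph w) u → IsPath (NGCAdj m G) (length G) (walkPath G u)
walkPath-isPath m G u = (λ i j eq → cong proj₁ eq) , (λ i j step → inj₁ (walk-layerEdge G u i j step))

walkEnd-auxEdge : ∀ {w} m (G : LGraph w) {u v} → walkEnd G u ≡ v → HasAuxEdge m v →
                  NGCAdj m G (walkPath G u (fromℕ (length G))) (walkPath G v zero)
walkEnd-auxEdge m G refl aux = inj₂ (inj₂ (inj₁ (refl , refl , refl , refl , aux)))

module _ {w} (m : ℕ) (G : LGraph w) (G-inj : All Injective G) where

  walkPaths-disjoint : ∀ {r} (start : Fin r → Slot w) → Injective start →
                       Disjoint (λ p → walkPath G (start p))
  walkPaths-disjoint start start-inj p q p≢q i j eq = p≢q (start-inj p q (walkPath-injective G-inj i j eq))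

  disjointWalkPaths : ∀ {r} (start : Fin r → Slot w) → Injective start →
                      HasDisjointPaths (NGCAdj m G) r (length G)
  disjointWalkPaths start start-inj =
    (λ p → walkPath G (start p)) , (λ p → walkPath-isPath m G (start p)) , walkPaths-disjoint start start-inj

  closedWalkCycles : ∀ {r} (start : Fin r → Slot w) → Injective start → 2 ≤ length G →
                     (∀ p → HasAuxEdge m (start p)) → (∀ p → walkEnd G (start p) ≡ start p) →
                     HasDisjointCycles (NGCAdj m G) r (depth G)
  closedWalkCycles start start-inj long aux closed =
    (λ p → walkPath G (start p)) ,
    (λ p → closePath (NGCAdj m G) (walkPath G (start p)) long (walkPath-isPath m G (start p))
             (walkEnd-auxEdge m G (closed p) (aux p))) ,
    walkPaths-disjoint start start-inj

  swappedWalkCycles : ∀ {r} (start : Fin r → Bool → Slot w) → Injective (uncurry start) → 1 ≤ length G →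
                      (∀ p s → HasAuxEdge m (start p s)) → (∀ p s → walkEnd G (start p s) ≡ start p (not s)) →
                      HasDisjointCycles (NGCAdj m G) r (depth G + depth G)
  swappedWalkCycles {r} start start-inj nonempty aux swap = cycle , isCycle , disjoint
    where
    cycle : Fin r → Fin (depth G + depth G) → Vertex G
    cycle p = walkPath G (start p false) ++ walkPath G (start p true)

    isCycle : ∀ p → IsCycle (NGCAdj m G) (depth G + depth G) (cycle p)
    isCycle p = joinPaths (NGCAdj m G) (+-mono-≤ nonempty (s≤s z≤n))
      (walkPath-isPath m G (start p false)) (walkPath-isPath m G (start p true))
      (λ i j eq → false≢true (cong proj₂ (start-inj _ _ (walkPath-injective G-inj i j eq))))
      (walkEnd-auxEdge m G (swap p false) (aux p true))
      (walkEnd-auxEdge m G (swap p true) (aux p false))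
      where
      false≢true : false ≢ true
      false≢true ()

    cycle-vertex : ∀ p a → Σ Bool λ s → Σ (Fin (depth G)) λ i → cycle p a ≡ walkPath G (start p s) i
    cycle-vertex p a with splitView (depth G) (depth G) a
    ... | left i  = false , i , lookup-++ˡ (walkPath G (start p false)) (walkPath G (start p true)) i
    ... | right i = true  , i , lookup-++ʳ (walkPath G (start p false)) (walkPath G (start p true)) i

    disjoint : Disjoint cycle
    disjoint p q p≢q a b eq with cycle-vertex p a | cycle-vertex q b
    ... | s , i , on-p | s′ , j , on-q =
      p≢q (cong proj₁ (start-inj (p , s) (q , s′) (walkPath-injective G-inj i j (trans (sym on-p) (trans eq on-q)))))

xor-involutiveʳ : ∀ b s → (s xor b) xor b ≡ s
xor-involutiveʳ b s = trans (xor-assoc s b b) (trans (cong (s xor_) (xor-same b)) (xor-identityʳ s))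

xor-cancelʳ : ∀ b {s s′} → s xor b ≡ s′ xor b → s ≡ s′
xor-cancelʳ b {s} {s′} eq = trans (sym (xor-involutiveʳ b s)) (trans (cong (_xor b) eq) (xor-involutiveʳ b s′))

PermMatch-injective : ∀ {w} (σ : Permutation′ w) → All Injective (PermMatch σ)
PermMatch-injective σ = (λ { (j , s) (j′ , s′) eq → cong₂ _,_ (σ-injective (cong proj₁ eq)) (cong proj₂ eq) }) ∷ []
  where
  σ-injective : ∀ {j j′} → σ ⟨$⟩ʳ j ≡ σ ⟨$⟩ʳ j′ → j ≡ j′
  σ-injective {j} {j′} eq = trans (sym (inverseˡ σ)) (trans (cong (σ ⟨$⟩ˡ_) eq) (inverseˡ σ))

XorMatch-injective : ∀ {w} (x : Fin w → Bool) → All Injective (XorMatch x)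
XorMatch-injective x = (λ { (j , s) (j′ , s′) eq → inj j s j′ s′ (cong proj₁ eq) (cong proj₂ eq) }) ∷ []
  where
  inj : ∀ j s j′ s′ → j ≡ j′ → s xor x j ≡ s′ xor x j′ → (j , s) ≡ (j′ , s′)
  inj j s .j s′ refl eq = cong (j ,_) (xor-cancelʳ (x j) eq)

MultiBlock-injective : ∀ {w t} (X : Vec (Fin w → Bool) t) (Σs : Vec (Permutation′ w) t) →
                       All Injective (MultiBlock X Σs)
MultiBlock-injective []      []        = []
MultiBlock-injective (x ∷ X) (σ ∷ Σs) =
  ++⁺ (++⁺ (PermMatch-injective σ) (++⁺ (XorMatch-injective x) (PermMatch-injective (flip σ))))
      (MultiBlock-injective X Σs)

length-MultiBlock : ∀ {w t} (X : Vec (Fin w → Bool) t) (Σs : Vec (Permutation′ w) t) →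
                    length (MultiBlock X Σs) ≡ 3 * t
length-MultiBlock []      []        = refl
length-MultiBlock {t = suc t} (x ∷ X) (σ ∷ Σs) = trans (cong (3 +_) (length-MultiBlock X Σs)) (sym (*-suc 3 t))

parity : ∀ {w t} → Vec (Fin w → Bool) t → Vec (Permutation′ w) t → Fin w → Bool
parity X Σs j = foldr′ _xor_ false (zipWith (λ x σ → x (σ ⟨$⟩ʳ j)) X Σs)

walkEnd-MultiBlock : ∀ {w t} (X : Vec (Fin w → Bool) t) (Σs : Vec (Permutation′ w) t) j s →
                     walkEnd (MultiBlock X Σs) (j , s) ≡ (j , s xor parity X Σs j)
walkEnd-MultiBlock []      []        j s = cong (j ,_) (sym (xor-identityʳ s))
walkEnd-MultiBlock (x ∷ X) (σ ∷ Σs) j s = begin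
  walkEnd (MultiBlock X Σs) (σ ⟨$⟩ˡ (σ ⟨$⟩ʳ j) , s xor x (σ ⟨$⟩ʳ j))
    ≡⟨ cong (λ j′ → walkEnd (MultiBlock X Σs) (j′ , s xor x (σ ⟨$⟩ʳ j))) (inverseˡ σ) ⟩
  walkEnd (MultiBlock X Σs) (j , s xor x (σ ⟨$⟩ʳ j))
    ≡⟨ walkEnd-MultiBlock X Σs j (s xor x (σ ⟨$⟩ʳ j)) ⟩
  (j , (s xor x (σ ⟨$⟩ʳ j)) xor parity X Σs j)
    ≡⟨ cong (j ,_) (xor-assoc s _ _) ⟩
  (j , s xor parity (x ∷ X) (σ ∷ Σs) j) ∎
  where open ≡-Reasoning

lowSlot : ∀ {m} → Fin m × Bool → Slot (2 * m)
lowSlot {m} (j , s) = (j ↑ˡ (m + 0) , s)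

lowSlot-hasAuxEdge : ∀ {m} (js : Fin m × Bool) → HasAuxEdge m (lowSlot js)
lowSlot-hasAuxEdge {m} (j , s) = subst (_< m) (sym (toℕ-↑ˡ j (m + 0))) (toℕ<n j)

lowSlot-injective : ∀ {m} → Injective (lowSlot {m})
lowSlot-injective {m} (j , s) (j′ , s′) eq = cong₂ _,_ (↑ˡ-injective (m + 0) j j′ (cong proj₁ eq)) (cong proj₂ eq)

tagHalf : ∀ {m} → Fin m ⊎ Fin m → Fin m × Bool
tagHalf = [ (_, false) , (_, true) ]

tagHalf-injective : ∀ {m} → Injective (tagHalf {m})
tagHalf-injective (inj₁ j) (inj₁ j′) eq = cong inj₁ (cong proj₁ eq)
tagHalf-injective (inj₂ j) (inj₂ j′) eq = cong inj₂ (cong proj₁ eq)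
tagHalf-injective (inj₁ j) (inj₂ j′) ()
tagHalf-injective (inj₂ j) (inj₁ j′) ()

half : ∀ m → Fin (m + m) → Fin m × Bool
half m p = tagHalf (splitAt m p)

half-injective : ∀ m → Injective (half m)
half-injective m p q eq = begin
  p                        ≡⟨ join-splitAt m m p ⟨
  join m m (splitAt m p)   ≡⟨ cong (join m m) (tagHalf-injective (splitAt m p) (splitAt m q) eq) ⟩
  join m m (splitAt m q)   ≡⟨ join-splitAt m m q ⟩
  q                        ∎
  where open ≡-Reasoning

quotient-2k : ∀ k m → 4 * suc k * m / (2 * suc k) ≡ m + m
quotient-2k k m = trans (cong (_/ (2 * suc k)) (eq k m)) (m*n/n≡m (m + m) (2 * suc k))
  where
  eq : ∀ k m → 4 * suc k * m ≡ (m + m) * (2 * suc k)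
  eq = solve-∀

quotient-4k : ∀ k m → 4 * suc k * m / (4 * suc k) ≡ m
quotient-4k k m = trans (cong (_/ (4 * suc k)) (eq k m)) (m*n/n≡m m (4 * suc k))
  where
  eq : ∀ k m → 4 * suc k * m ≡ m * (4 * suc k)
  eq = solve-∀

lemma3p12 : (t m : ℕ) → 1 ≤ t → 1 ≤ m →
    (θ : Bool) (X : Vec (Fin (2 * m) → Bool) t) (Σs : Vec (Permutation′ (2 * m)) t) →
    ParityCond m θ X Σs →
    ((θ ≡ false → HasDisjointCycles (NGCAdj m (MultiBlock X Σs)) ((4 * (1 + 3 * t) * m) / (2 * (1 + 3 * t))) (1 + 3 * t))
     × (θ ≡ true → HasDisjointCycles (NGCAdj m (MultiBlock X Σs)) ((4 * (1 + 3 * t) * m) / (4 * (1 + 3 * t))) (2 * (1 + 3 * t)))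
     × HasDisjointPaths (NGCAdj m (MultiBlock X Σs)) ((4 * (1 + 3 * t) * m) / (2 * (1 + 3 * t))) ((1 + 3 * t) ∸ 1))
lemma3p12 t m 1≤t _ θ X Σs parity≡θ =
    (λ { refl → subst₂ (HasDisjointCycles Adj) (sym (quotient-2k (3 * t) m)) (cong suc len)
                  (closedWalkCycles m G G-inj start start-injective long
                     (lowSlot-hasAuxEdge ∘ half m) (fixed refl ∘ half m)) })
  , (λ { refl → subst₂ (HasDisjointCycles Adj) (sym (quotient-4k (3 * t) m))
                  (trans (double (depth G)) (cong (λ n → 2 * suc n) len))
                  (swappedWalkCycles m G G-inj (curry lowSlot) lowSlot-injective (<⇒≤ long)
                     (curry lowSlot-hasAuxEdge) (swapped refl)) })
  , subst₂ (HasDisjointPaths Adj) (sym (quotient-2k (3 * t) m)) len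
      (disjointWalkPaths m G G-inj start start-injective)
  where
  G : LGraph (2 * m)
  G = MultiBlock X Σs

  Adj : Vertex G → Vertex G → Set
  Adj = NGCAdj m G

  G-inj : All Injective G
  G-inj = MultiBlock-injective X Σs

  len : length G ≡ 3 * t
  len = length-MultiBlock X Σs

  start : Fin (m + m) → Slot (2 * m)
  start = lowSlot ∘ half m

  start-injective : Injective start
  start-injective p q = half-injective m p q ∘ lowSlot-injective (half m p) (half m q)

  long : 2 ≤ length G
  long = subst (2 ≤_) (sym len) (≤-trans (s≤s (s≤s z≤n)) (*-monoʳ-≤ 3 1≤t))

  endpoint : ∀ (j : Fin m) s → walkEnd G (lowSlot (j , s)) ≡ lowSlot (j , s xor θ)
  endpoint j s = trans (walkEnd-MultiBlock X Σs _ s) (cong (λ b → lowSlot (j , s xor b)) (parity≡θ _ (lowSlot-hasAuxEdge (j , s))))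

  fixed : θ ≡ false → ∀ (js : Fin m × Bool) → walkEnd G (lowSlot js) ≡ lowSlot js
  fixed refl (j , s) = trans (endpoint j s) (cong (lowSlot ∘ (j ,_)) (xor-identityʳ s))

  swapped : θ ≡ true → ∀ (j : Fin m) s → walkEnd G (lowSlot (j , s)) ≡ lowSlot (j , not s)
  swapped refl j s = trans (endpoint j s) (cong (lowSlot ∘ (j ,_)) (trans (xor-comm s true) (true-xor s)))

  double : ∀ n → n + n ≡ 2 * n
  double = solve-∀
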